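{- Every class of graphs that admits low rank-width colorings has the Erdős–Hajnal property.
   Context: All graphs are finite and simple. A graph class $\mathcal{C}$ has the Erdős–Hajnal property if there is $\epsilon>0$, depending only on $\mathcal{C}$, such that every $n$-vertex graph in $\mathcal{C}$ has an independent set or a clique of size at least $n^{\epsilon}$. Rank-width: for a graph $G$ and $X\subseteq V(G)$, $\mathrm{cutrk}_G(X)$ is the rank over GF(2) of the adjacency submatrix with rows $X$ and columns $V(G)\setminus X$; a rank-decomposition is a tree with all nodes of degree 1 or 3 whose leaves are in bijection with $V(G)$, an edge $e$ has width $\mathrm{cutrk}_G$ of the vertex set on one side of $e$, and the rank-width is the minimum over rank-decompositions of the maximum edge width ($0$ for graphs with at most one vertex). A class $\mathcal{D}$ of graphs admits low rank-width colorings if there exist functions $N,Q\colon\mathbb{N}\to\mathbb{N}$ such that for all $p\in\mathbb{N}$, every $G\in\mathcal{D}$ can be vertex colored with at most $N(p)$ colors such that the union of any $i\le p$ color classes induces a subgraph of rank-width at most $Q(i)$. -}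

module Defs where

open import Data.Nat using (ℕ; zero; suc; _≤_; _^_)
open import Data.Bool using (Bool; true; false; _∧_; _xor_)
open import Data.Fin using (Fin; zero; suc)
open import Data.Fin.Subset using (Subset; _∈_; ∣_∣)
open import Data.Vec using (tabulate; lookup)
open import Data.Product using (Σ; ∃; _×_; _,_; proj₁)
open import Data.Sum using (_⊎_)
open import Relation.Nullary using (¬_)
open import Relation.Binary.PropositionalEquality using (_≡_; _≢_)

record Graph (V : Set) : Set where
  field
    adj    : V → V → Bool
    sym    : ∀ x y → adj x y ≡ adj y x
    irrefl : ∀ x → adj x x ≡ false
open Graph public

induced : {V : Set} → Graph V → (W : V → Bool) → Graph (Σ V (λ v → W v ≡ true))
induced G W = record
  { adj    = λ x y → adj G (proj₁ x) (proj₁ y)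
  ; sym    = λ x y → sym G (proj₁ x) (proj₁ y)
  ; irrefl = λ x → irrefl G (proj₁ x) }

-- GF(2) arithmetic: sum (xor) of a family of k bits

xorSum : {k : ℕ} → (Fin k → Bool) → Bool
xorSum {zero}  f = false
xorSum {suc k} f = f zero xor xorSum (λ j → f (suc j))

-- cutrk_G(X) ≤ k : the GF(2) rank of the adjacency submatrix with rows X
-- and columns V∖X is at most k, i.e. its row space is spanned by k
-- vectors (indexed by the columns): every row x ∈ X is a GF(2)-linear
-- combination of k fixed column-indexed vectors.
CutRankLE : {V : Set} → Graph V → (X : V → Set) → ℕ → Set
CutRankLE {V} G X k =
  Σ (Fin k → V → Bool) λ vs →
    ∀ x → X x → Σ (Fin k → Bool) λ c →
      ∀ y → ¬ X y → adj G x y ≡ xorSum (λ j → c j ∧ vs j y)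

data Walk {m : ℕ} (T : Fin m → Fin m → Bool) : Fin m → Fin m → Set where
  here : ∀ {u} → Walk T u u
  step : ∀ {u w v} → T u w ≡ true → Walk T w v → Walk T u v

data AvoidWalk {m : ℕ} (T : Fin m → Fin m → Bool) (a b : Fin m)
     : Fin m → Fin m → Set where
  here : ∀ {u} → AvoidWalk T a b u u
  step : ∀ {u w v} → T u w ≡ true →
         ¬ ((u ≡ a × w ≡ b) ⊎ (u ≡ b × w ≡ a)) →
         AvoidWalk T a b w v → AvoidWalk T a b u v

degree : {m : ℕ} → (Fin m → Fin m → Bool) → Fin m → ℕ
degree T u = ∣ tabulate (T u) ∣

record RankDecomposition {V : Set} (G : Graph V) (k : ℕ) : Set where
  field
    m         : ℕ
    T         : Fin m → Fin m → Bool
    T-sym     : ∀ u v → T u v ≡ T v u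
    T-irrefl  : ∀ u → T u u ≡ false
    -- T is a tree: connected, and every edge is a bridge (acyclic)
    connected : ∀ u v → Walk T u v
    acyclic   : ∀ a b → T a b ≡ true → ¬ AvoidWalk T a b a b
    degree13  : ∀ u → degree T u ≡ 1 ⊎ degree T u ≡ 3
    leaf      : V → Fin m
    leaf-inj  : ∀ x y → leaf x ≡ leaf y → x ≡ y
    leaf-deg  : ∀ x → degree T (leaf x) ≡ 1
    leaf-onto : ∀ u → degree T u ≡ 1 → ∃ λ x → leaf x ≡ u
    -- every edge ab has width ≤ k: the vertices whose leaves lie on the
    -- a-side of ab (the component of a in T − ab) have cut-rank ≤ k
    width     : ∀ a b → T a b ≡ true →
                CutRankLE G (λ x → AvoidWalk T a b a (leaf x)) k

-- rank-width ≤ k (graphs with at most one vertex have rank-width 0)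
RankWidthLE : {V : Set} → Graph V → ℕ → Set
RankWidthLE {V} G k = (∀ (x y : V) → x ≡ y) ⊎ RankDecomposition G k

GraphClass : Set₁
GraphClass = (n : ℕ) → Graph (Fin n) → Set

LowRankWidthColorings : GraphClass → Set
LowRankWidthColorings C =
  Σ (ℕ → ℕ) λ N → Σ (ℕ → ℕ) λ Q →
    ∀ (p n : ℕ) (G : Graph (Fin n)) → C n G →
      Σ (Fin n → Fin (N p)) λ col →
        ∀ (S : Subset (N p)) → ∣ S ∣ ≤ p →
          RankWidthLE (induced G (λ v → lookup S (col v))) (Q ∣ S ∣)

IsClique : {n : ℕ} → Graph (Fin n) → Subset n → Set
IsClique G S = ∀ x y → x ∈ S → y ∈ S → x ≢ y → adj G x y ≡ true

IsIndependent : {n : ℕ} → Graph (Fin n) → Subset n → Set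
IsIndependent G S = ∀ x y → x ∈ S → y ∈ S → adj G x y ≡ false

-- Erdős–Hajnal property with exponent ε = a / b (a, b ≥ 1):
-- every n-vertex graph in C has a clique or independent set S with
-- |S| ≥ n^(a/b), i.e. n^a ≤ |S|^b.
ErdosHajnal : GraphClass → Set
ErdosHajnal C =
  Σ ℕ λ a → Σ ℕ λ b → 1 ≤ a × 1 ≤ b ×
    (∀ (n : ℕ) (G : Graph (Fin n)) → C n G →
      Σ (Subset n) λ S → (IsIndependent G S ⊎ IsClique G S) ×
        n ^ a ≤ ∣ S ∣ ^ b)

module Submission where

-- Colour with p = 1: each colour class induces a subgraph of rank-width at
-- most k = Q(1), and by pigeonhole some class U has at least n/N(1) vertices.
-- The heart of the proof is a product bound for graphs of rank-width ≤ k: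
-- every vertex set U contains an independent set I and a clique K with
-- |U| ≤ (|I|·|K|)^(k+3).  Then max(|I|,|K|)^(N(1) + 2(k+3)) ≥ n.
--
-- The product bound follows, by induction on |U|, from homogeneous splits:
-- disjoint A, B ⊆ U, each a 2^-(k+3) fraction of U, with all or no edges
-- between them; the bounds for A and B glue to one for U.  A split is found
-- at an edge of the rank-decomposition splitting U into thirds A₀ and B₀: the
-- cut-rank bound gives every vertex of A₀ one of 2^k coefficient vectors that
-- determine its neighbours in B₀.

open import Data.Nat
open import Data.Nat.Properties
open import Data.Bool using (Bool; true; false; _∧_; _∨_; _xor_; not; if_then_else_)
open import Data.Bool.Properties using (∧-conicalˡ; ∧-conicalʳ; ∧-identityʳ; ∧-zeroʳ; ¬-not)
  renaming (_≟_ to _≟ᵇ_)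
open import Data.Fin using (Fin; zero; suc; toℕ; fromℕ<)
  renaming (_≟_ to _≟ᶠ_)
open import Data.Fin.Properties using (any?; toℕ-injective; toℕ-fromℕ<; toℕ<n)
open import Data.Fin.Subset using (Subset; ∣_∣; _∈_; ⁅_⁆; inside)
open import Data.Fin.Subset.Properties using (x∈⁅x⁆; ∣⁅x⁆∣≡1)
open import Data.Vec using (tabulate; lookup; []; _∷_)
open import Data.Vec.Properties using ([]=⇒lookup; lookup∘tabulate)
open import Data.Product
open import Data.Sum
open import Data.Empty
open import Function using (_∘_)
open import Relation.Nullary
open import Relation.Nullary.Decidable using (dec-true; dec-false; map′)
open import Axiom.UniquenessOfIdentityProofs using (module Decidable⇒UIP)
open import Relation.Binary.PropositionalEquality hiding ([_])
open import Data.Nat.Solver using (module +-*-Solver)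
open +-*-Solver using (solve; _:*_; _:=_)

open import Defs hiding (sym)

VSet : ℕ → Set
VSet n = Fin n → Bool

_⊆_ : {n : ℕ} → VSet n → VSet n → Set
U ⊆ U′ = ∀ x → U x ≡ true → U′ x ≡ true

does-true : {A : Set} (a? : Dec A) → does a? ≡ true → A
does-true (yes a) _ = a

_==_ : {n : ℕ} → Fin n → Fin n → Bool
x == y = does (x ≟ᶠ y)

-- membership proofs W x ≡ true are unique
Bool-UIP : {a b : Bool} (p q : a ≡ b) → p ≡ q
Bool-UIP = Decidable⇒UIP.≡-irrelevant _≟ᵇ_

true≢false : {b : Bool} → b ≡ true → b ≢ false
true≢false refl ()

tail : {n : ℕ} → VSet (suc n) → VSet n
tail U i = U (suc i)

size : {n : ℕ} → VSet n → ℕ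
size {zero}  U = 0
size {suc n} U = (if U zero then 1 else 0) + size (tail U)

single : {n : ℕ} → Fin n → VSet n
single x y = y == x

_∩_ _∖_ _∪_ : {n : ℕ} → VSet n → VSet n → VSet n
(U ∩ P) x = U x ∧ P x
(U ∖ P) x = U x ∧ not (P x)
(U ∪ P) x = U x ∨ P x

infixl 7 _∩_ _∖_
infixl 6 _∪_

Disjoint : {n : ℕ} → VSet n → VSet n → Set
Disjoint U U′ = ∀ x → U x ≡ true → U′ x ≡ true → ⊥

single-refl : {n : ℕ} (x : Fin n) → single x x ≡ true
single-refl x = dec-true (x ≟ᶠ x) refl

single-elim : {n : ℕ} {x y : Fin n} → single x y ≡ true → y ≡ x
single-elim {x = x} {y} = does-true (y ≟ᶠ x)

size-cong : {n : ℕ} (U U′ : VSet n) → (∀ x → U x ≡ U′ x) → size U ≡ size U′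
size-cong {zero}  U U′ e = refl
size-cong {suc n} U U′ e =
  cong₂ _+_ (cong (λ b → if b then 1 else 0) (e zero))
            (size-cong (tail U) (tail U′) (λ i → e (suc i)))

size-mono : {n : ℕ} (U U′ : VSet n) → U ⊆ U′ → size U ≤ size U′
size-mono {zero}  U U′ s = z≤n
size-mono {suc n} U U′ s with U zero in e | U′ zero in e′
... | false | false = size-mono (tail U) (tail U′) (λ x → s (suc x))
... | false | true  = m≤n⇒m≤1+n (size-mono (tail U) (tail U′) (λ x → s (suc x)))
... | true  | true  = s≤s (size-mono (tail U) (tail U′) (λ x → s (suc x)))
... | true  | false = ⊥-elim (true≢false (s zero e) e′)

size-≤ : {n : ℕ} (U : VSet n) → size U ≤ n
size-≤ {zero}  U = z≤n
size-≤ {suc n} U with U zero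
... | true  = s≤s (size-≤ (tail U))
... | false = m≤n⇒m≤1+n (size-≤ (tail U))

size-full : {n : ℕ} → size {n} (λ _ → true) ≡ n
size-full {zero}  = refl
size-full {suc n} = cong suc (size-full {n})

size-split : {n : ℕ} (U P : VSet n) → size U ≡ size (U ∩ P) + size (U ∖ P)
size-split {zero}  U P = refl
size-split {suc n} U P with U zero | P zero
... | false | _     = size-split (tail U) (tail P)
... | true  | true  = cong suc (size-split (tail U) (tail P))
... | true  | false = trans (cong suc (size-split (tail U) (tail P))) (sym (+-suc _ _))

size-∪ : {n : ℕ} (U U′ : VSet n) → size (U ∪ U′) ≤ size U + size U′
size-∪ {zero}  U U′ = z≤n
size-∪ {suc n} U U′ with U zero | U′ zero
... | false | false = size-∪ (tail U) (tail U′)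
... | false | true  = ≤-trans (s≤s (size-∪ (tail U) (tail U′))) (≤-reflexive (sym (+-suc _ _)))
... | true  | false = s≤s (size-∪ (tail U) (tail U′))
... | true  | true  = s≤s (≤-trans (size-∪ (tail U) (tail U′)) (+-monoʳ-≤ _ (n≤1+n _)))

size-disjoint-∪ : {n : ℕ} (U U′ : VSet n) → Disjoint U U′ →
                  size (U ∪ U′) ≡ size U + size U′
size-disjoint-∪ {zero}  U U′ d = refl
size-disjoint-∪ {suc n} U U′ d with U zero in e | U′ zero in e′
... | false | false = size-disjoint-∪ (tail U) (tail U′) (λ x → d (suc x))
... | false | true  = trans (cong suc (size-disjoint-∪ (tail U) (tail U′) (λ x → d (suc x)))) (sym (+-suc _ _))
... | true  | false = cong suc (size-disjoint-∪ (tail U) (tail U′) (λ x → d (suc x)))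
... | true  | true  = ⊥-elim (d zero e e′)

nonempty : {n : ℕ} (U : VSet n) → 0 < size U → ∃ λ x → U x ≡ true
nonempty {suc n} U pos with U zero in e
... | true  = zero , e
... | false = let (x , ux) = nonempty (tail U) pos in suc x , ux

size-pos : {n : ℕ} (U : VSet n) {x : Fin n} → U x ≡ true → 0 < size U
size-pos {suc n} U {zero}  ux rewrite ux = s≤s z≤n
size-pos {suc n} U {suc x} ux with U zero
... | true  = s≤s z≤n
... | false = size-pos (tail U) ux

member : {n k : ℕ} (U : VSet n) → size U ≡ suc k → ∃ λ x → U x ≡ true
member U e = nonempty U (subst (0 <_) (sym e) (s≤s z≤n))

size-single : {n : ℕ} (x : Fin n) → size (single x) ≡ 1
size-single {suc n} zero    = cong suc (size-empty n)
  where
  size-empty : ∀ m → size {m} (λ _ → false) ≡ 0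
  size-empty zero    = refl
  size-empty (suc m) = size-empty m
size-single {suc n} (suc x) = size-single x

single-≢ : {n : ℕ} {x y : Fin n} → y ≢ x → single x y ≡ false
single-≢ {x = x} {y} = dec-false (y ≟ᶠ x)

single-false : {n : ℕ} {x y : Fin n} → single x y ≡ false → y ≢ x
single-false {x = x} e refl = true≢false (single-refl x) e

∩-intro : {n : ℕ} (U P : VSet n) {x : Fin n} → U x ≡ true → P x ≡ true → (U ∩ P) x ≡ true
∩-intro U P ux px rewrite ux | px = refl

∪-introˡ : {n : ℕ} (X Y : VSet n) {x : Fin n} → X x ≡ true → (X ∪ Y) x ≡ true
∪-introˡ X Y ex rewrite ex = refl

∪-introʳ : {n : ℕ} (X Y : VSet n) {x : Fin n} → Y x ≡ true → (X ∪ Y) x ≡ true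
∪-introʳ X Y {x} ey with X x
... | true  = refl
... | false = ey

∖-intro : {n : ℕ} (U P : VSet n) {x : Fin n} → U x ≡ true → P x ≡ false → (U ∖ P) x ≡ true
∖-intro U P ux px rewrite ux | px = refl

∖-elim : {n : ℕ} (U P : VSet n) {x : Fin n} → (U ∖ P) x ≡ true → U x ≡ true × P x ≡ false
∖-elim U P {x} e with U x | P x
... | true | false = refl , refl

∪-elim : {n : ℕ} (X Y : VSet n) {x : Fin n} → (X ∪ Y) x ≡ true → X x ≡ true ⊎ Y x ≡ true
∪-elim X Y {x} e with X x
... | true  = inj₁ refl
... | false = inj₂ e

∪-⊆ : {n : ℕ} {X Y U : VSet n} → X ⊆ U → Y ⊆ U → (X ∪ Y) ⊆ U
∪-⊆ {X = X} {Y} X⊆U Y⊆U x e = [ X⊆U x , Y⊆U x ] (∪-elim X Y e)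

larger-of : {n : ℕ} (P : VSet n → Set) (Y₁ Y₂ : VSet n) → P Y₁ → P Y₂ →
            Σ (VSet n) λ Y → P Y × size Y₁ ⊔ size Y₂ ≤ size Y
larger-of P Y₁ Y₂ p₁ p₂ with ≤-total (size Y₁) (size Y₂)
... | inj₁ ≤₂ = Y₂ , p₂ , ⊔-lub ≤₂ ≤-refl
... | inj₂ ≥₂ = Y₁ , p₁ , ⊔-lub ≤-refl ≥₂

size-remove : {n : ℕ} (U : VSet n) {x : Fin n} → U x ≡ true →
              size U ≡ suc (size (U ∖ single x))
size-remove U {x} ux = begin
  size U                                     ≡⟨ size-split U (single x) ⟩
  size (U ∩ single x) + size (U ∖ single x)  ≡⟨ cong (_+ size (U ∖ single x)) size-∩ ⟩
  suc (size (U ∖ single x))                  ∎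
  where
  open ≡-Reasoning
  size-∩ : size (U ∩ single x) ≡ 1
  size-∩ = trans (size-cong (U ∩ single x) (single x) only-x) (size-single x)
    where
    only-x : ∀ y → (U ∩ single x) y ≡ single x y
    only-x y with y ≟ᶠ x
    ... | yes refl = trans (∧-identityʳ (U y)) ux
    ... | no _     = ∧-zeroʳ (U y)

size-strict : {n : ℕ} (U U′ : VSet n) {x : Fin n} → U ⊆ U′ → U′ x ≡ true → U x ≡ false →
              size U < size U′
size-strict U U′ {x} U⊆U′ u′x ux =
  subst (size U <_) (sym (size-remove U′ u′x)) (s≤s (size-mono U (U′ ∖ single x) U⊆U′∖x))
  where
  U⊆U′∖x : U ⊆ (U′ ∖ single x)
  U⊆U′∖x y uy = ∖-intro U′ (single x) (U⊆U′ y uy) (single-≢ {x = x} {y} λ { refl → true≢false uy ux })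

size-≤1 : {n : ℕ} (U : VSet n) → (∀ x y → U x ≡ true → U y ≡ true → x ≡ y) → size U ≤ 1
size-≤1 U uniq with size U in e
... | zero  = z≤n
... | suc _ with member U e
...   | x , ux = subst (_≤ 1) e (≤-trans (size-mono U (single x) U⊆x) (≤-reflexive (size-single x)))
  where
  U⊆x : U ⊆ single x
  U⊆x y uy = dec-true (y ≟ᶠ x) (uniq y x uy ux)

⊆-or-witness : {n : ℕ} (U U′ : VSet n) → U ⊆ U′ ⊎ ∃ λ x → U x ≡ true × U′ x ≡ false
⊆-or-witness U U′ with any? (λ x → (U x ≟ᵇ true) ×-dec (U′ x ≟ᵇ false))
... | yes witness = inj₂ witness
... | no none     = inj₁ (λ x ux → ¬-not (λ u′x → none (x , ux , u′x)))

size-tabulate : {n : ℕ} (U : VSet n) → ∣ tabulate U ∣ ≡ size U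
size-tabulate {zero}  U = refl
size-tabulate {suc n} U with U zero
... | true  = cong suc (size-tabulate (tail U))
... | false = size-tabulate (tail U)

size-remove-suc : {n k : ℕ} (U : VSet n) {x : Fin n} → U x ≡ true → size U ≡ suc k →
                  size (U ∖ single x) ≡ k
size-remove-suc U ux e = suc-injective (trans (sym (size-remove U ux)) e)

size≤1-unique : {n : ℕ} (U : VSet n) {x y : Fin n} → size U ≤ 1 →
                U x ≡ true → U y ≡ true → y ≡ x
size≤1-unique U {x} {y} U≤1 ux uy with y ≟ᶠ x
... | yes y≡x = y≡x
... | no  y≢x = ⊥-elim (<⇒≱ (s≤s (size-pos (U ∖ single x) (∖-intro U (single x) uy (single-≢ y≢x))))
                            (subst (_≤ 1) (size-remove U ux) U≤1))

size-pair : {n : ℕ} {x y : Fin n} → y ≢ x → size (single x ∪ single y) ≡ 2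
size-pair {x = x} {y} y≢x =
  trans (size-disjoint-∪ (single x) (single y)
          (λ z ex ey → y≢x (trans (sym (single-elim {y = z} ey)) (single-elim {y = z} ex))))
        (cong₂ _+_ (size-single x) (size-single y))

record ThreeMembers {n : ℕ} (U : VSet n) (b : Fin n) : Set where
  field
    w₁ w₂   : Fin n
    in₁     : U w₁ ≡ true
    in₂     : U w₂ ≡ true
    w₁≢b    : w₁ ≢ b
    w₂≢b    : w₂ ≢ b
    covered : ∀ w → U w ≡ true → w ≡ b ⊎ w ≡ w₁ ⊎ w ≡ w₂

three-members : {n : ℕ} (U : VSet n) {b : Fin n} → size U ≡ 3 → U b ≡ true → ThreeMembers U b
three-members U {b} e ub = record
  { w₁ = w₁ ; w₂ = w₂ ; in₁ = proj₁ in₁′ ; in₂ = proj₁ in₂′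
  ; w₁≢b = single-false (proj₂ in₁′) ; w₂≢b = single-false (proj₂ in₂′) ; covered = covered }
  where
  U₁ : VSet _
  U₁ = U ∖ single b
  size₁ : size U₁ ≡ 2
  size₁ = size-remove-suc U ub e
  w₁ : Fin _
  w₁ = proj₁ (member U₁ size₁)
  w₁∈U₁ : U₁ w₁ ≡ true
  w₁∈U₁ = proj₂ (member U₁ size₁)
  U₂ : VSet _
  U₂ = U₁ ∖ single w₁
  size₂ : size U₂ ≡ 1
  size₂ = size-remove-suc U₁ w₁∈U₁ size₁
  w₂ : Fin _
  w₂ = proj₁ (member U₂ size₂)
  w₂∈U₂ : U₂ w₂ ≡ true
  w₂∈U₂ = proj₂ (member U₂ size₂)
  in₁′ : U w₁ ≡ true × single b w₁ ≡ false
  in₁′ = ∖-elim U (single b) w₁∈U₁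
  in₂′ : U w₂ ≡ true × single b w₂ ≡ false
  in₂′ = ∖-elim U (single b) (proj₁ (∖-elim U₁ (single w₁) w₂∈U₂))
  covered : ∀ w → U w ≡ true → w ≡ b ⊎ w ≡ w₁ ⊎ w ≡ w₂
  covered w uw with w ≟ᶠ b | w ≟ᶠ w₁
  ... | yes w≡b | _        = inj₁ w≡b
  ... | no _    | yes w≡w₁ = inj₂ (inj₁ w≡w₁)
  ... | no w≢b  | no w≢w₁  = inj₂ (inj₂ (size≤1-unique U₂ (≤-reflexive size₂) w₂∈U₂
          (∖-intro U₁ (single w₁) (∖-intro U (single b) uw (single-≢ w≢b)) (single-≢ w≢w₁))))

two-members : {n : ℕ} (U : VSet n) → 2 ≤ size U → ∃₂ λ x y → U x ≡ true × U y ≡ true × y ≢ x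
two-members U 2≤U with nonempty U (≤-trans (s≤s z≤n) 2≤U)
... | x , ux with nonempty (U ∖ single x) (s≤s⁻¹ (subst (2 ≤_) (size-remove U ux) 2≤U))
...   | y , y∈U∖x = x , y , ux , proj₁ (∖-elim U (single x) y∈U∖x) ,
                    single-false (proj₂ (∖-elim U (single x) y∈U∖x))

-- An increasing chain of subsets of Fin m becomes stationary: it cannot grow
-- strictly more than m times.
chain-stabilises : {m : ℕ} (R : ℕ → VSet m) → (∀ i → R i ⊆ R (suc i)) →
                   ∃ λ j → R (suc j) ⊆ R j
chain-stabilises {m} R inc with growth (suc m)
  where
  growth : ∀ i → (∃ λ j → R (suc j) ⊆ R j) ⊎ i ≤ size (R i)
  growth zero = inj₂ z≤n
  growth (suc i) with growth i
  ... | inj₁ stationary = inj₁ stationary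
  ... | inj₂ i≤ with ⊆-or-witness (R (suc i)) (R i)
  ...   | inj₁ stationary    = inj₁ (i , stationary)
  ...   | inj₂ (x , new , old) = inj₂ (≤-<-trans i≤ (size-strict (R i) (R (suc i)) (inc i) new old))
... | inj₁ stationary = stationary
... | inj₂ too-big    = ⊥-elim (<⇒≱ (s≤s (size-≤ (R (suc m)))) too-big)

-- Reachability in a finite directed graph E is decidable: the sets of
-- vertices reachable from s in at most i steps form an increasing chain, and
-- its stationary stage contains exactly the reachable vertices.

walk-snoc : {m : ℕ} {E : Fin m → Fin m → Bool} {s w u : Fin m} →
            Walk E s w → E w u ≡ true → Walk E s u
walk-snoc here         e = step e here
walk-snoc (step e′ p) e = step e′ (walk-snoc p e)

module Reachability {m : ℕ} (E : Fin m → Fin m → Bool) (s : Fin m) where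

  Extends : VSet m → Fin m → Set
  Extends R u = R u ≡ true ⊎ ∃ λ w → R w ≡ true × E w u ≡ true

  extends? : (R : VSet m) (u : Fin m) → Dec (Extends R u)
  extends? R u = (R u ≟ᵇ true) ⊎-dec any? (λ w → (R w ≟ᵇ true) ×-dec (E w u ≟ᵇ true))

  within : ℕ → VSet m
  within zero    = single s
  within (suc i) = λ u → does (extends? (within i) u)

  within-inc : ∀ i → within i ⊆ within (suc i)
  within-inc i u r = dec-true (extends? (within i) u) (inj₁ r)

  within-start : ∀ i → within i s ≡ true
  within-start zero    = single-refl s
  within-start (suc i) = within-inc i s (within-start i)

  within-sound : ∀ i u → within i u ≡ true → Walk E s u
  within-sound zero    u r rewrite single-elim {x = s} {u} r = here
  within-sound (suc i) u r with does-true (extends? (within i) u) r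
  ... | inj₁ r′            = within-sound i u r′
  ... | inj₂ (w , r′ , e) = walk-snoc (within-sound i w r′) e

  stationary : ∃ λ j → within (suc j) ⊆ within j
  stationary = chain-stabilises within within-inc

  within-closed : ∀ w u → within (proj₁ stationary) w ≡ true → Walk E w u →
                  within (proj₁ stationary) u ≡ true
  within-closed w .w r here = r
  within-closed w u  r (step {w = v} e p) =
    within-closed v u (proj₂ stationary v (dec-true (extends? (within (proj₁ stationary)) v) (inj₂ (w , r , e)))) p

  reachable? : ∀ u → Dec (Walk E s u)
  reachable? u with within (proj₁ stationary) u in r
  ... | true  = yes (within-sound (proj₁ stationary) u r)
  ... | false = no (λ p → true≢false (within-closed s u (within-start (proj₁ stationary)) p) r)

data WalkAvoiding {m : ℕ} (E : Fin m → Fin m → Bool) (a : Fin m) : Fin m → Fin m → Set where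
  here : ∀ {u} → u ≢ a → WalkAvoiding E a u u
  step : ∀ {u w x} → u ≢ a → E u w ≡ true → WalkAvoiding E a w x → WalkAvoiding E a u x

module _ {m : ℕ} {E : Fin m → Fin m → Bool} where

  avoiding-start : ∀ {a u x} → WalkAvoiding E a u x → u ≢ a
  avoiding-start (here u≢a)     = u≢a
  avoiding-start (step u≢a _ _) = u≢a

  avoiding-mono : ∀ {E′ a u x} → (∀ u w → E u w ≡ true → E′ u w ≡ true) →
                  WalkAvoiding E a u x → WalkAvoiding E′ a u x
  avoiding-mono E⊆E′ (here u≢a)     = here u≢a
  avoiding-mono E⊆E′ (step u≢a e p) = step u≢a (E⊆E′ _ _ e) (avoiding-mono E⊆E′ p)

  last-visit : ∀ {u x} (a : Fin m) → Walk E u x →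
               WalkAvoiding E a u x ⊎ x ≡ a ⊎ ∃ λ w → E a w ≡ true × WalkAvoiding E a w x
  last-visit {u} a here with u ≟ᶠ a
  ... | yes u≡a = inj₂ (inj₁ u≡a)
  ... | no  u≢a = inj₁ (here u≢a)
  last-visit {u} a (step {w = w} e p) with last-visit a p
  ... | inj₂ later = inj₂ later
  ... | inj₁ avoiding with u ≟ᶠ a
  ...   | yes refl = inj₂ (inj₂ (w , e , avoiding))
  ...   | no  u≢a  = inj₁ (step u≢a e avoiding)

  first-visit : ∀ {u x} (a : Fin m) → Walk E u x → WalkAvoiding E a u x ⊎ Walk E u a
  first-visit {u} a p with u ≟ᶠ a
  first-visit a p           | yes refl = inj₂ here
  first-visit a here        | no u≢a   = inj₁ (here u≢a)
  first-visit a (step e p)  | no u≢a with first-visit a p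
  ... | inj₁ avoiding = inj₁ (step u≢a e avoiding)
  ... | inj₂ prefix   = inj₂ (step e prefix)

module TreeSides {m : ℕ} (T : Fin m → Fin m → Bool)
  (T-sym : ∀ u v → T u v ≡ T v u) (T-irrefl : ∀ u → T u u ≡ false)
  (acyclic : ∀ a b → T a b ≡ true → ¬ AvoidWalk T a b a b) where

  OnEdge : Fin m → Fin m → Fin m → Fin m → Set
  OnEdge p q u w = (u ≡ p × w ≡ q) ⊎ (u ≡ q × w ≡ p)

  on-edge? : ∀ p q u w → Dec (OnEdge p q u w)
  on-edge? p q u w = ((u ≟ᶠ p) ×-dec (w ≟ᶠ q)) ⊎-dec ((u ≟ᶠ q) ×-dec (w ≟ᶠ p))

  on-edge : Fin m → Fin m → Fin m → Fin m → Bool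
  on-edge p q u w = does (on-edge? p q u w)

  T-without : Fin m → Fin m → Fin m → Fin m → Bool
  T-without p q u = T u ∖ on-edge p q u

  -- walks avoiding the edge pq are the walks in T-without p q, so avoiding
  -- walks are decidable by reachability
  T-without⊆T : ∀ p q u w → T-without p q u w ≡ true → T u w ≡ true
  T-without⊆T p q u w = ∧-conicalˡ (T u w) _

  avoid⇒walk : ∀ {p q u x} → AvoidWalk T p q u x → Walk (T-without p q) u x
  avoid⇒walk here = here
  avoid⇒walk {p} {q} {u} (step {w = w} e off p′) =
    step (∖-intro (T u) (on-edge p q u) e (dec-false (on-edge? p q u w) off)) (avoid⇒walk p′)

  walk⇒avoid : ∀ {p q u x} → Walk (T-without p q) u x → AvoidWalk T p q u x
  walk⇒avoid here = here
  walk⇒avoid {p} {q} {u} (step {w = w} e p′) with ∖-elim (T u) (on-edge p q u) e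
  ... | e′ , off = step e′ (λ on → true≢false (dec-true (on-edge? p q u w) on) off) (walk⇒avoid p′)

  avoid? : ∀ p q u x → Dec (AvoidWalk T p q u x)
  avoid? p q u x with Reachability.reachable? (T-without p q) u x
  ... | yes w = yes (walk⇒avoid w)
  ... | no ¬w = no (λ a → ¬w (avoid⇒walk a))

  edge-irrefl : ∀ {a b} → T a b ≡ true → a ≢ b
  edge-irrefl {a} tab refl = true≢false tab (T-irrefl a)

  avoiding⇒avoid : ∀ {a p q u x} → a ≡ p ⊎ a ≡ q → WalkAvoiding T a u x → AvoidWalk T p q u x
  avoiding⇒avoid a∈pq (here _) = here
  avoiding⇒avoid {a} a∈pq (step u≢a e p) = step e off (avoiding⇒avoid a∈pq p)
    where
    w≢a : _ ≢ a
    w≢a = avoiding-start p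
    off : ¬ OnEdge _ _ _ _
    off (inj₁ (refl , refl)) = [ (λ a≡p → u≢a (sym a≡p)) , (λ a≡q → w≢a (sym a≡q)) ] a∈pq
    off (inj₂ (refl , refl)) = [ (λ a≡p → w≢a (sym a≡p)) , (λ a≡q → u≢a (sym a≡q)) ] a∈pq

  off-edge : ∀ {a b w} → T a b ≡ true → w ≢ b → ¬ OnEdge a b a w
  off-edge tab w≢b (inj₁ (_ , w≡b))  = w≢b w≡b
  off-edge tab w≢b (inj₂ (a≡b , _)) = edge-irrefl tab a≡b

  side : Fin m → Fin m → VSet m
  side a b u = does (avoid? a b a u)

  a∉side-wa : ∀ {a w} → T a w ≡ true → ¬ AvoidWalk T w a w a
  a∉side-wa {a} {w} taw = acyclic w a (trans (T-sym w a) taw)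

  side-nested : ∀ {a b w x} → T a b ≡ true → T a w ≡ true → w ≢ b →
                AvoidWalk T w a w x → AvoidWalk T a b a x
  side-nested {a} {b} {w} tab taw w≢b p with first-visit a (avoid⇒walk p)
  ... | inj₂ prefix   = ⊥-elim (a∉side-wa taw (walk⇒avoid prefix))
  ... | inj₁ avoiding = step taw (off-edge tab w≢b)
                          (avoiding⇒avoid (inj₁ refl) (avoiding-mono (T-without⊆T w a) avoiding))

  side-shrinks : ∀ {a b w} → T a b ≡ true → T a w ≡ true → w ≢ b →
                 size (side w a) < size (side a b)
  side-shrinks {a} {b} {w} tab taw w≢b =
    size-strict (side w a) (side a b)
      (λ u e → dec-true (avoid? a b a u) (side-nested tab taw w≢b (does-true (avoid? w a w u) e)))
      (dec-true (avoid? a b a a) here)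
      (dec-false (avoid? w a w a) (a∉side-wa taw))

  side-split : ∀ {a b x} → AvoidWalk T a b a x →
               x ≡ a ⊎ ∃ λ w → T a w ≡ true × w ≢ b × AvoidWalk T w a w x
  side-split {a} {b} p with last-visit a (avoid⇒walk p)
  ... | inj₁ avoiding               = ⊥-elim (avoiding-start avoiding refl)
  ... | inj₂ (inj₁ x≡a)             = inj₁ x≡a
  ... | inj₂ (inj₂ (w , e , avoiding)) with ∖-elim (T a) (on-edge a b a) e
  ...   | taw , off = inj₂ (w , taw , w≢b , avoiding⇒avoid (inj₂ refl) (avoiding-mono (T-without⊆T a b) avoiding))
    where
    w≢b : w ≢ b
    w≢b w≡b = true≢false (dec-true (on-edge? a b a w) (inj₁ (refl , w≡b))) off

  module _ {ℓ a : Fin m} (leaf : size (T ℓ) ≡ 1) (tℓa : T ℓ a ≡ true) where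

    leaf-side : ∀ {x} → AvoidWalk T ℓ a ℓ x → x ≡ ℓ
    leaf-side p with side-split p
    ... | inj₁ x≡ℓ                   = x≡ℓ
    ... | inj₂ (w , tℓw , w≢a , _) = ⊥-elim (w≢a (size≤1-unique (T ℓ) (≤-reflexive leaf) tℓa tℓw))

    leaf-edge-side : ∀ {x} → Walk T a x → x ≢ ℓ → AvoidWalk T a ℓ a x
    leaf-edge-side {x} p x≢ℓ with last-visit a p
    ... | inj₁ avoiding                  = ⊥-elim (avoiding-start avoiding refl)
    ... | inj₂ (inj₁ refl)               = here
    ... | inj₂ (inj₂ (w , taw , avoiding)) with w ≟ᶠ ℓ
    ...   | no w≢ℓ   = step taw (off-edge (trans (T-sym a ℓ) tℓa) w≢ℓ) (avoiding⇒avoid (inj₁ refl) avoiding)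
    ...   | yes refl = ⊥-elim (stuck avoiding)
      where
      -- a walk from ℓ avoiding a cannot leave ℓ, and x ≠ ℓ
      stuck : WalkAvoiding T a ℓ x → ⊥
      stuck (here _)         = x≢ℓ refl
      stuck (step _ tℓw′ r) = avoiding-start r (size≤1-unique (T ℓ) (≤-reflexive leaf) tℓa tℓw′)

^-distribʳ-* : ∀ a b d → (a * b) ^ d ≡ a ^ d * b ^ d
^-distribʳ-* a b zero    = refl
^-distribʳ-* a b (suc d) = trans (cong (a * b *_) (^-distribʳ-* a b d))
  (solve 4 (λ a b x y → (a :* b) :* (x :* y) := (a :* x) :* (b :* y)) refl a b (a ^ d) (b ^ d))

doubled-power : ∀ d {p q} → p ≤ q → 2 ^ d * p ^ d ≤ (p + q) ^ d
doubled-power d {p} {q} p≤q = begin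
  2 ^ d * p ^ d   ≡⟨ ^-distribʳ-* 2 p d ⟨
  (2 * p) ^ d     ≡⟨ cong (λ t → (p + t) ^ d) (+-identityʳ p) ⟩
  (p + p) ^ d     ≤⟨ ^-monoˡ-≤ d (+-monoʳ-≤ p p≤q) ⟩
  (p + q) ^ d     ∎
  where open ≤-Reasoning

-- If s ≤ 2^d·cA and s ≤ 2^d·cB where cA ≤ pA^d and cB ≤ pB^d, then s ≤ (pA + pB)^d:
-- compare with the smaller of pA, pB.
power-of-sum : ∀ d {s cA cB} pA pB → s ≤ 2 ^ d * cA → s ≤ 2 ^ d * cB →
               cA ≤ pA ^ d → cB ≤ pB ^ d → s ≤ (pA + pB) ^ d
power-of-sum d pA pB sA sB cA≤ cB≤ with ≤-total pA pB
... | inj₁ pA≤pB = ≤-trans sA (≤-trans (*-monoʳ-≤ (2 ^ d) cA≤) (doubled-power d pA≤pB))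
... | inj₂ pB≤pA = ≤-trans sB (≤-trans (*-monoʳ-≤ (2 ^ d) cB≤)
                     (subst (2 ^ d * pB ^ d ≤_) (cong (_^ d) (+-comm pB pA)) (doubled-power d pB≤pA)))

products≤ : ∀ a₁ b₁ a₂ b₂ → a₁ * b₁ + a₂ * b₂ ≤ (a₁ + a₂) * (b₁ ⊔ b₂)
products≤ a₁ b₁ a₂ b₂ = begin
  a₁ * b₁ + a₂ * b₂             ≤⟨ +-mono-≤ (*-monoʳ-≤ a₁ (m≤m⊔n b₁ b₂)) (*-monoʳ-≤ a₂ (m≤n⊔m b₁ b₂)) ⟩
  a₁ * (b₁ ⊔ b₂) + a₂ * (b₁ ⊔ b₂) ≡⟨ *-distribʳ-+ (b₁ ⊔ b₂) a₁ a₂ ⟨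
  (a₁ + a₂) * (b₁ ⊔ b₂)         ∎
  where open ≤-Reasoning

third-of-rest : ∀ {s a b} → s ≡ a + b → 3 * a ≤ 2 * s → s ≤ 3 * b
third-of-rest {s} {a} {b} s≡ 3a≤ = +-cancelˡ-≤ (2 * s) s (3 * b) (begin
  2 * s + s        ≡⟨ +-comm (2 * s) s ⟩
  3 * s            ≡⟨ cong (3 *_) s≡ ⟩
  3 * (a + b)      ≡⟨ *-distribˡ-+ 3 a b ⟩
  3 * a + 3 * b    ≤⟨ +-monoˡ-≤ (3 * b) 3a≤ ⟩
  2 * s + 3 * b    ∎)
  where open ≤-Reasoning

two-thirds : ∀ {s f f₁ f₂} → f ≤ f₁ + f₂ → 3 * f₁ < s → 3 * f₂ < s → 3 * f ≤ 2 * s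
two-thirds {s} {f} {f₁} {f₂} f≤ f₁< f₂< = begin
  3 * f              ≤⟨ *-monoʳ-≤ 3 f≤ ⟩
  3 * (f₁ + f₂)      ≡⟨ *-distribˡ-+ 3 f₁ f₂ ⟩
  3 * f₁ + 3 * f₂    ≤⟨ +-mono-≤ (<⇒≤ f₁<) (<⇒≤ f₂<) ⟩
  s + s              ≡⟨ cong (s +_) (+-identityʳ s) ⟨
  2 * s              ∎
  where open ≤-Reasoning

positive-part : ∀ {s} c {t} → 0 < s → s ≤ c * t → 0 < t
positive-part {s} c {zero} pos s≤ = ⊥-elim (<⇒≱ pos (subst (s ≤_) (*-zeroʳ c) s≤))
positive-part     c {suc t} _   _  = s≤s z≤n

all-but-one : ∀ {r f} → 3 ≤ r → r ≤ f → suc r ≤ 3 * f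
all-but-one {r} {f} 3≤r r≤f = begin
  1 + r              ≤⟨ +-monoˡ-≤ r (≤-trans (s≤s z≤n) 3≤r) ⟩
  r + r              ≤⟨ +-monoʳ-≤ r (m≤m+n r (r + 0)) ⟩
  3 * r              ≤⟨ *-monoʳ-≤ 3 r≤f ⟩
  3 * f              ∎
  where open ≤-Reasoning

larger-half : ∀ {c a b} → c ≡ a + b → b ≤ a → c ≤ 2 * a
larger-half {c} {a} {b} c≡ b≤a = begin
  c        ≡⟨ c≡ ⟩
  a + b    ≤⟨ +-monoʳ-≤ a b≤a ⟩
  a + a    ≡⟨ cong (a +_) (+-identityʳ a) ⟨
  2 * a    ∎
  where open ≤-Reasoning

fraction-bound : ∀ {s c c′ j} k → s ≤ 3 * c → c ≤ 2 ^ j * c′ → j ≤ suc k → s ≤ 2 ^ (k + 3) * c′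
fraction-bound {s} {c} {c′} {j} k s≤ c≤ j≤ = begin
  s                  ≤⟨ s≤ ⟩
  3 * c              ≤⟨ *-mono-≤ (n≤1+n 3) c≤ ⟩
  4 * (2 ^ j * c′)   ≡⟨ *-assoc 4 (2 ^ j) c′ ⟨
  4 * 2 ^ j * c′     ≡⟨ cong (_* c′) (*-assoc 2 2 (2 ^ j)) ⟩
  2 ^ (2 + j) * c′   ≤⟨ *-monoˡ-≤ c′ (^-monoʳ-≤ 2 (subst (2 + j ≤_) (+-comm 3 k) (s≤s (s≤s j≤)))) ⟩
  2 ^ (k + 3) * c′   ∎
  where open ≤-Reasoning

add-class : ∀ {s q s₀ k r t} → s ≡ q + s₀ → s₀ ≤ k * r → q ≤ t → r ≤ t → s ≤ suc k * t
add-class {k = k} s≡ s₀≤ q≤t r≤t =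
  ≤-trans (≤-reflexive s≡) (+-mono-≤ q≤t (≤-trans s₀≤ (*-monoʳ-≤ k r≤t)))

n≤2^n : ∀ n → n ≤ 2 ^ n
n≤2^n zero    = z≤n
n≤2^n (suc n) = begin
  1 + n          ≤⟨ +-mono-≤ (m^n>0 2 n) (n≤2^n n) ⟩
  2 ^ n + 2 ^ n  ≡⟨ cong (2 ^ n +_) (+-identityʳ (2 ^ n)) ⟨
  2 * 2 ^ n      ∎
  where open ≤-Reasoning

power-absorbs : ∀ {n N M} d → 2 ≤ M → n ≤ N * (M * M) ^ d → n ≤ M ^ (N + 2 * d)
power-absorbs {n} {N} {M} d 2≤M n≤ = begin
  n                   ≤⟨ n≤ ⟩
  N * (M * M) ^ d     ≤⟨ *-monoˡ-≤ ((M * M) ^ d) (≤-trans (n≤2^n N) (^-monoˡ-≤ N 2≤M)) ⟩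
  M ^ N * (M * M) ^ d ≡⟨ cong (M ^ N *_) (^-distribʳ-* M M d) ⟩
  M ^ N * (M ^ d * M ^ d) ≡⟨ cong (M ^ N *_) (^-distribˡ-+-* M d d) ⟨
  M ^ N * M ^ (d + d) ≡⟨ cong (λ t → M ^ N * M ^ (d + t)) (+-identityʳ d) ⟨
  M ^ N * M ^ (2 * d) ≡⟨ ^-distribˡ-+-* M N (2 * d) ⟨
  M ^ (N + 2 * d)     ∎
  where open ≤-Reasoning

module Homogeneity {n : ℕ} (G : Graph (Fin n)) where

  -- distinct members of X are adjacent exactly when β holds:
  -- an independent set for β = false, a clique for β = true
  Homogeneous : Bool → VSet n → Set
  Homogeneous β X = ∀ x y → X x ≡ true → X y ≡ true → x ≢ y → adj G x y ≡ β

  Joined : Bool → VSet n → VSet n → Set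
  Joined β X Y = ∀ x y → X x ≡ true → Y y ≡ true → adj G x y ≡ β

  single-homogeneous : ∀ β x → Homogeneous β (single x)
  single-homogeneous β x y z ey ez y≢z = ⊥-elim (y≢z (trans (single-elim ey) (sym (single-elim ez))))

  union-homogeneous : ∀ {β X Y} → Homogeneous β X → Homogeneous β Y → Joined β X Y →
                      Homogeneous β (X ∪ Y)
  union-homogeneous {β} {X} {Y} hX hY joined x y ex ey x≢y with ∪-elim X Y ex | ∪-elim X Y ey
  ... | inj₁ x∈X | inj₁ y∈X = hX x y x∈X y∈X x≢y
  ... | inj₂ x∈Y | inj₂ y∈Y = hY x y x∈Y y∈Y x≢y
  ... | inj₁ x∈X | inj₂ y∈Y = joined x y x∈X y∈Y
  ... | inj₂ x∈Y | inj₁ y∈X = trans (Graph.sym G x y) (joined y x y∈X x∈Y)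

  record ProductBound (d : ℕ) (U : VSet n) : Set where
    field
      part        : Bool → VSet n
      part⊆U      : ∀ β → part β ⊆ U
      homogeneous : ∀ β → Homogeneous β (part β)
      bound       : size U ≤ (size (part false) * size (part true)) ^ d

    product-at : ∀ β → size (part false) * size (part true) ≡ size (part β) * size (part (not β))
    product-at false = refl
    product-at true  = *-comm (size (part false)) (size (part true))

  bound-from : ∀ {d U} β (X Y : VSet n) → X ⊆ U → Y ⊆ U →
               Homogeneous β X → Homogeneous (not β) Y → size U ≤ (size X * size Y) ^ d →
               ProductBound d U
  bound-from false X Y X⊆U Y⊆U hX hY bnd = record
    { part = λ γ → if γ then Y else X
    ; part⊆U = λ { false → X⊆U ; true → Y⊆U }
    ; homogeneous = λ { false → hX ; true → hY }
    ; bound = bnd }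
  bound-from {d} {U} true X Y X⊆U Y⊆U hX hY bnd = record
    { part = λ γ → if γ then X else Y
    ; part⊆U = λ { false → Y⊆U ; true → X⊆U }
    ; homogeneous = λ { false → hY ; true → hX }
    ; bound = subst (λ p → size U ≤ p ^ d) (*-comm (size X) (size Y)) bnd }

  -- Gluing: if disjoint A, B ⊆ U are β-joined and each holds a 2^-d fraction of
  -- U, bounds for A and B give a bound for U, using the union of their
  -- β-homogeneous parts and the larger of their (not β)-homogeneous parts.
  glue : ∀ {d U A B} β → A ⊆ U → B ⊆ U → Disjoint A B → Joined β A B →
         size U ≤ 2 ^ d * size A → size U ≤ 2 ^ d * size B →
         ProductBound d A → ProductBound d B → ProductBound d U
  glue {d} {U} {A} {B} β A⊆U B⊆U disjoint joined U≤A U≤B PA PB =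
    bound-from β X Y X⊆U Y⊆U hX hY bnd
    where
    module PA = ProductBound PA
    module PB = ProductBound PB
    XA XB YA YB : VSet n
    XA = PA.part β
    XB = PB.part β
    YA = PA.part (not β)
    YB = PB.part (not β)
    X : VSet n
    X = XA ∪ XB
    X⊆U : X ⊆ U
    X⊆U = ∪-⊆ (λ x e → A⊆U x (PA.part⊆U β x e)) (λ x e → B⊆U x (PB.part⊆U β x e))
    hX : Homogeneous β X
    hX = union-homogeneous (PA.homogeneous β) (PB.homogeneous β)
           (λ x y ex ey → joined x y (PA.part⊆U β x ex) (PB.part⊆U β y ey))
    size-X : size X ≡ size XA + size XB
    size-X = size-disjoint-∪ XA XB (λ x ex ey → disjoint x (PA.part⊆U β x ex) (PB.part⊆U β x ey))
    larger : Σ (VSet n) λ Y → (Y ⊆ U × Homogeneous (not β) Y) × size YA ⊔ size YB ≤ size Y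
    larger = larger-of (λ Y → Y ⊆ U × Homogeneous (not β) Y) YA YB
               ((λ x e → A⊆U x (PA.part⊆U (not β) x e)) , PA.homogeneous (not β))
               ((λ x e → B⊆U x (PB.part⊆U (not β) x e)) , PB.homogeneous (not β))
    Y : VSet n
    Y = proj₁ larger
    Y⊆U : Y ⊆ U
    Y⊆U = proj₁ (proj₁ (proj₂ larger))
    hY : Homogeneous (not β) Y
    hY = proj₂ (proj₁ (proj₂ larger))
    -- |U| ≤ (|XA||YA| + |XB||YB|)^d ≤ ((|XA| + |XB|) · max(|YA|,|YB|))^d
    bnd : size U ≤ (size X * size Y) ^ d
    bnd = ≤-trans
      (power-of-sum d (size XA * size YA) (size XB * size YB) U≤A U≤B
        (subst (λ p → size A ≤ p ^ d) (PA.product-at β) PA.bound)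
        (subst (λ p → size B ≤ p ^ d) (PB.product-at β) PB.bound))
      (^-monoˡ-≤ d (≤-trans (products≤ (size XA) (size YA) (size XB) (size YB))
                            (*-mono-≤ (≤-reflexive (sym size-X)) (proj₂ (proj₂ larger)))))

  tiny-bound : ∀ {d U} → size U ≤ 1 → ProductBound d U
  tiny-bound {d} {U} U≤1 =
    bound-from false U U (λ _ e → e) (λ _ e → e) at-most-one at-most-one (self-bound (size U) U≤1)
    where
    at-most-one : ∀ {β} → Homogeneous β U
    at-most-one x y ex ey x≢y = ⊥-elim (x≢y (size≤1-unique U U≤1 ey ex))
    self-bound : ∀ s → s ≤ 1 → s ≤ (s * s) ^ d
    self-bound zero    _ = z≤n
    self-bound (suc _) (s≤s z≤n) = ≤-reflexive (sym (^-zeroˡ d))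

  -- Two distinct members x, y of a set of at most three vertices give a bound:
  -- {x, y} is homogeneous with respect to their adjacency, and {x} is homogeneous.
  pair-bound : ∀ {d U x y} → 2 ≤ d → size U ≤ 3 → U x ≡ true → U y ≡ true → y ≢ x →
               ProductBound d U
  pair-bound {d} {U} {x} {y} 2≤d U≤3 ux uy y≢x =
    bound-from β (single x ∪ single y) (single x) (∪-⊆ (one ux) (one uy)) (one ux)
      (union-homogeneous (single-homogeneous β x) (single-homogeneous β y) joined)
      (single-homogeneous (not β) x) bnd
    where
    β : Bool
    β = adj G x y
    one : ∀ {z} → U z ≡ true → single z ⊆ U
    one {z} uz w e = subst (λ v → U v ≡ true) (sym (single-elim e)) uz
    joined : Joined β (single x) (single y)
    joined x′ y′ ex ey = cong₂ (adj G) (single-elim ex) (single-elim ey)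
    bnd : size U ≤ (size (single x ∪ single y) * size (single x)) ^ d
    bnd = begin
      size U                                              ≤⟨ ≤-trans U≤3 (n≤1+n 3) ⟩
      2 ^ 2                                               ≤⟨ ^-monoʳ-≤ 2 2≤d ⟩
      2 ^ d                                               ≡⟨ cong₂ (λ a b → (a * b) ^ d) (size-pair y≢x) (size-single x) ⟨
      (size (single x ∪ single y) * size (single x)) ^ d  ∎
      where open ≤-Reasoning

  small-bound : ∀ {d U} → 2 ≤ d → size U ≤ 3 → ProductBound d U
  small-bound {d} {U} 2≤d U≤3 with size U ≤? 1
  ... | yes U≤1 = tiny-bound U≤1
  ... | no  U≰1 with two-members U (≰⇒> U≰1)
  ...   | x , y , ux , uy , y≢x = pair-bound 2≤d U≤3 ux uy y≢x

  record HomogeneousSplit (d : ℕ) (U : VSet n) : Set where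
    field
      A B        : VSet n
      β          : Bool
      A⊆U        : A ⊆ U
      B⊆U        : B ⊆ U
      disjoint   : Disjoint A B
      joined     : Joined β A B
      A-large    : size U ≤ 2 ^ d * size A
      B-large    : size U ≤ 2 ^ d * size B
      A-smaller  : size A < size U
      B-smaller  : size B < size U

  bound-by-splitting : ∀ {d} (W : VSet n) → 2 ≤ d →
                       (∀ U → U ⊆ W → 4 ≤ size U → HomogeneousSplit d U) →
                       ∀ U → U ⊆ W → ProductBound d U
  bound-by-splitting {d} W 2≤d split U U⊆W = by-size (suc (size U)) U U⊆W ≤-refl
    where
    by-size : ∀ F U → U ⊆ W → size U < F → ProductBound d U
    by-size (suc F) U U⊆W U<F with size U ≤? 3
    ... | yes U≤3 = small-bound 2≤d U≤3
    ... | no  U≰3 =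
      glue β A⊆U B⊆U disjoint joined A-large B-large
        (by-size F A (λ x e → U⊆W x (A⊆U x e)) (<-≤-trans A-smaller (s≤s⁻¹ U<F)))
        (by-size F B (λ x e → U⊆W x (B⊆U x e)) (<-≤-trans B-smaller (s≤s⁻¹ U<F)))
      where open HomogeneousSplit (split U U⊆W (≰⇒> U≰3))

halve : {n : ℕ} (A P : VSet n) →
        Σ (VSet n) λ A′ → A′ ⊆ A × size A ≤ 2 * size A′ × Σ Bool λ β → ∀ x → A′ x ≡ true → P x ≡ β
halve A P with ≤-total (size (A ∖ P)) (size (A ∩ P))
... | inj₁ out≤in = A ∩ P , (λ x e → ∧-conicalˡ (A x) (P x) e) , larger-half (size-split A P) out≤in ,
                    true , (λ x e → ∧-conicalʳ (A x) (P x) e)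
... | inj₂ in≤out = A ∖ P , (λ x e → proj₁ (∖-elim A P e)) ,
                    larger-half (trans (size-split A P) (+-comm (size (A ∩ P)) _)) in≤out ,
                    false , (λ x e → proj₂ (∖-elim A P e))

split-by-bits : {n : ℕ} (k : ℕ) (bits : Fin n → Fin k → Bool) (A : VSet n) →
                Σ (VSet n) λ A′ → A′ ⊆ A × size A ≤ 2 ^ k * size A′ ×
                  (∀ x y → A′ x ≡ true → A′ y ≡ true → ∀ j → bits x j ≡ bits y j)
split-by-bits zero    bits A = A , (λ x e → e) , ≤-reflexive (sym (+-identityʳ (size A))) , λ x y _ _ ()
split-by-bits (suc k) bits A with halve A (λ x → bits x zero)
... | A₁ , A₁⊆A , A≤A₁ , β , first-bit with split-by-bits k (λ x j → bits x (suc j)) A₁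
...   | A′ , A′⊆A₁ , A₁≤A′ , other-bits = A′ , (λ x e → A₁⊆A x (A′⊆A₁ x e)) , A≤A′ , same
  where
  A≤A′ : size A ≤ 2 ^ suc k * size A′
  A≤A′ = ≤-trans A≤A₁ (≤-trans (*-monoʳ-≤ 2 A₁≤A′) (≤-reflexive (sym (*-assoc 2 (2 ^ k) (size A′)))))
  same : ∀ x y → A′ x ≡ true → A′ y ≡ true → ∀ j → bits x j ≡ bits y j
  same x y ex ey zero    = trans (first-bit x (A′⊆A₁ x ex)) (sym (first-bit y (A′⊆A₁ y ey)))
  same x y ex ey (suc j) = other-bits x y ex ey j

xorSum-cong : {k : ℕ} (f g : Fin k → Bool) → (∀ j → f j ≡ g j) → xorSum f ≡ xorSum g
xorSum-cong {zero}  f g e = refl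
xorSum-cong {suc k} f g e =
  cong₂ _xor_ (e zero) (xorSum-cong (λ j → f (suc j)) (λ j → g (suc j)) (λ j → e (suc j)))

module Decomposition {n : ℕ} (G : Graph (Fin n)) (W : VSet n) {k : ℕ}
                     (RD : RankDecomposition (induced G W) k) where
  open RankDecomposition RD
  open TreeSides T T-sym T-irrefl acyclic
  open Homogeneity G

  degree≡size : ∀ u → degree T u ≡ size (T u)
  degree≡size u = size-tabulate (T u)

  OnSide : Fin m → Fin m → Fin n → Set
  OnSide a b x = Σ (W x ≡ true) λ x∈W → AvoidWalk T a b a (leaf (x , x∈W))

  on-side? : ∀ a b x → Dec (OnSide a b x)
  on-side? a b x with W x ≟ᵇ true
  ... | no  x∉W = no (λ s → x∉W (proj₁ s))
  ... | yes x∈W = map′ (x∈W ,_) any-proof (avoid? a b a (leaf (x , x∈W)))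
    where
    any-proof : OnSide a b x → AvoidWalk T a b a (leaf (x , x∈W))
    any-proof (x∈W′ , p) = subst (λ q → AvoidWalk T a b a (leaf (x , q))) (Bool-UIP x∈W′ x∈W) p

  vside : Fin m → Fin m → VSet n
  vside a b x = does (on-side? a b x)

  vside-intro : ∀ {a b x} x∈W → AvoidWalk T a b a (leaf (x , x∈W)) → vside a b x ≡ true
  vside-intro {a} {b} {x} x∈W p = dec-true (on-side? a b x) (x∈W , p)

  vside-elim : ∀ {a b x} → vside a b x ≡ true → OnSide a b x
  vside-elim {a} {b} {x} = does-true (on-side? a b x)

  vside-outside : ∀ {a b x} x∈W → vside a b x ≡ false → ¬ AvoidWalk T a b a (leaf (x , x∈W))
  vside-outside x∈W e p = true≢false (vside-intro x∈W p) e

  leaf-injective : ∀ {x y} (x∈W : W x ≡ true) (y∈W : W y ≡ true) →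
                   leaf (x , x∈W) ≡ leaf (y , y∈W) → x ≡ y
  leaf-injective x∈W y∈W e = cong proj₁ (leaf-inj _ _ e)

  module Balance (U : VSet n) where

    share : Fin m → Fin m → ℕ
    share a b = size (U ∩ vside a b)

    BalancedEdge : Set
    BalancedEdge = Σ (Fin m) λ a → Σ (Fin m) λ b →
                     T a b ≡ true × size U ≤ 3 * share a b × 3 * share a b ≤ 2 * size U

    share-at-leaf : ∀ {a b} → degree T a ≡ 1 → T a b ≡ true → share a b ≤ 1
    share-at-leaf {a} {b} d₁ tab = size-≤1 (U ∩ vside a b) λ x y ex ey →
      leaf-injective _ _ (trans (leaf-is-a x ex) (sym (leaf-is-a y ey)))
      where
      leaf-is-a : ∀ x (e : (U ∩ vside a b) x ≡ true) →
                  leaf (x , proj₁ (vside-elim (∧-conicalʳ (U x) _ e))) ≡ a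
      leaf-is-a x e = leaf-side (trans (sym (degree≡size a)) d₁) tab (proj₂ (vside-elim (∧-conicalʳ (U x) _ e)))

    -- At a node a of degree three, the a-side of ab is covered by the sides of
    -- the two other neighbours (no vertex has a as its leaf).
    share-split : ∀ {a b} → degree T a ≡ 3 → (nb : ThreeMembers (T a) b) →
                  share a b ≤ share (ThreeMembers.w₁ nb) a + share (ThreeMembers.w₂ nb) a
    share-split {a} {b} d₃ nb =
      ≤-trans (size-mono (U ∩ vside a b) (U ∩ vside w₁ a ∪ U ∩ vside w₂ a) covered-by)
              (size-∪ (U ∩ vside w₁ a) (U ∩ vside w₂ a))
      where
      open ThreeMembers nb
      covered-by : (U ∩ vside a b) ⊆ (U ∩ vside w₁ a ∪ U ∩ vside w₂ a)
      covered-by x e with vside-elim (∧-conicalʳ (U x) _ e)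
      ... | x∈W , p with side-split p
      ...   | inj₁ leaf≡a =
        ⊥-elim (1≢3 (trans (sym (leaf-deg (x , x∈W))) (subst (λ u → degree T u ≡ 3) (sym leaf≡a) d₃)))
        where 1≢3 : 1 ≢ 3
              1≢3 ()
      ...   | inj₂ (w , taw , w≢b , p′) with covered w taw
      ...     | inj₁ w≡b         = ⊥-elim (w≢b w≡b)
      ...     | inj₂ (inj₁ refl) = ∪-introˡ (U ∩ vside w₁ a) (U ∩ vside w₂ a)
                                     (∩-intro U (vside w₁ a) (∧-conicalˡ (U x) _ e) (vside-intro x∈W p′))
      ...     | inj₂ (inj₂ refl) = ∪-introʳ (U ∩ vside w₁ a) (U ∩ vside w₂ a)
                                     (∩-intro U (vside w₂ a) (∧-conicalˡ (U x) _ e) (vside-intro x∈W p′))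

    -- Starting from an edge whose a-side holds a third of U, move to a neighbouring
    -- edge with a smaller side as long as that side still holds a third; when no
    -- move is possible, the current edge is balanced.
    descend : ∀ F a b → size (side a b) < F → 4 ≤ size U → T a b ≡ true →
              size U ≤ 3 * share a b → BalancedEdge
    descend (suc F) a b side<F big tab third with degree13 a
    ... | inj₁ d₁ = ⊥-elim (<⇒≱ big (≤-trans third (*-monoʳ-≤ 3 (share-at-leaf d₁ tab))))
    ... | inj₂ d₃ with three-members (T a) (trans (sym (degree≡size a)) d₃) tab
    ...   | nb@record { w₁ = w₁ ; w₂ = w₂ ; in₁ = in₁ ; in₂ = in₂ ; w₁≢b = w₁≢b ; w₂≢b = w₂≢b }
          with size U ≤? 3 * share w₁ a | size U ≤? 3 * share w₂ a
    ...     | yes third₁ | _ = descend F w₁ a (≤-trans (side-shrinks tab in₁ w₁≢b) (s≤s⁻¹ side<F)) big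
                                 (trans (T-sym w₁ a) in₁) third₁
    ...     | no _ | yes third₂ = descend F w₂ a (≤-trans (side-shrinks tab in₂ w₂≢b) (s≤s⁻¹ side<F)) big
                                    (trans (T-sym w₂ a) in₂) third₂
    ...     | no ¬third₁ | no ¬third₂ =
      a , b , tab , third ,
      two-thirds {f₁ = share w₁ a} {f₂ = share w₂ a} (share-split d₃ nb) (≰⇒> ¬third₁) (≰⇒> ¬third₂)

    -- The edge at the leaf of any vertex x₀ ∈ U: its far side holds all of U but x₀.
    leaf-edge : U ⊆ W → 4 ≤ size U →
                Σ (Fin m) λ a → Σ (Fin m) λ ℓ → T a ℓ ≡ true × size U ≤ 3 * share a ℓ
    leaf-edge U⊆W big with nonempty U (≤-trans (s≤s z≤n) big)
    ... | x₀ , ux₀ = a , ℓ , trans (T-sym a ℓ) tℓa ,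
                     subst (_≤ 3 * share a ℓ) (sym (size-remove U ux₀))
                       (all-but-one (s≤s⁻¹ (subst (4 ≤_) (size-remove U ux₀) big))
                                    (size-mono (U ∖ single x₀) (U ∩ vside a ℓ) rest-on-side))
      where
      ℓ : Fin m
      ℓ = leaf (x₀ , U⊆W x₀ ux₀)
      ℓ-leaf : size (T ℓ) ≡ 1
      ℓ-leaf = trans (sym (degree≡size ℓ)) (leaf-deg (x₀ , U⊆W x₀ ux₀))
      a : Fin m
      a = proj₁ (member (T ℓ) ℓ-leaf)
      tℓa : T ℓ a ≡ true
      tℓa = proj₂ (member (T ℓ) ℓ-leaf)
      rest-on-side : (U ∖ single x₀) ⊆ (U ∩ vside a ℓ)
      rest-on-side x e = ∩-intro U (vside a ℓ) ux
        (vside-intro x∈W (leaf-edge-side ℓ-leaf tℓa (connected a (leaf (x , x∈W)))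
          (λ same-leaf → single-false (proj₂ (∖-elim U (single x₀) e))
                                      (leaf-injective x∈W (U⊆W x₀ ux₀) same-leaf))))
        where
        ux : U x ≡ true
        ux = proj₁ (∖-elim U (single x₀) e)
        x∈W : W x ≡ true
        x∈W = U⊆W x ux

    balanced-edge : U ⊆ W → 4 ≤ size U → BalancedEdge
    balanced-edge U⊆W big with leaf-edge U⊆W big
    ... | a , ℓ , taℓ , third = descend (suc (size (side a ℓ))) a ℓ ≤-refl big taℓ third

  -- By the width bound at an edge ab, the adjacency between a vertex x on the
  -- a-side and a vertex y off it is a GF(2) combination, with coefficients
  -- depending only on x, of k values depending only on y.
  module Across (a b : Fin m) (tab : T a b ≡ true) where

    rank : CutRankLE (induced G W) (λ x → AvoidWalk T a b a (leaf x)) k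
    rank = width a b tab

    coefficients : Fin n → Fin k → Bool
    coefficients x = from-side (on-side? a b x)
      where
      from-side : Dec (OnSide a b x) → Fin k → Bool
      from-side (yes (x∈W , p)) = proj₁ (proj₂ rank (x , x∈W) p)
      from-side (no _)           = λ _ → false

    adjacency-across : ∀ x y (y∈W : W y ≡ true) → vside a b x ≡ true → vside a b y ≡ false →
                       adj G x y ≡ xorSum (λ j → coefficients x j ∧ proj₁ rank j (y , y∈W))
    adjacency-across x y y∈W x-on y-off with on-side? a b x
    ... | yes (x∈W , p) = proj₂ (proj₂ rank (x , x∈W) p) (y , y∈W) (vside-outside y∈W y-off)

    same-neighbours : ∀ x x′ y → W y ≡ true → vside a b x ≡ true → vside a b x′ ≡ true →
                      vside a b y ≡ false → (∀ j → coefficients x j ≡ coefficients x′ j) →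
                      adj G x y ≡ adj G x′ y
    same-neighbours x x′ y y∈W x-on x′-on y-off same = begin
      adj G x y                                              ≡⟨ adjacency-across x y y∈W x-on y-off ⟩
      xorSum (λ j → coefficients x j ∧ proj₁ rank j (y , y∈W))
        ≡⟨ xorSum-cong _ _ (λ j → cong (_∧ proj₁ rank j (y , y∈W)) (same j)) ⟩
      xorSum (λ j → coefficients x′ j ∧ proj₁ rank j (y , y∈W)) ≡⟨ adjacency-across x′ y y∈W x′-on y-off ⟨
      adj G x′ y                                             ∎
      where open ≡-Reasoning

  -- The homogeneous split of U at a balanced edge ab: U splits into its part A₀
  -- on the a-side and the rest B₀, each holding a third of U; A is a 2^-k
  -- fraction of A₀ with equal coefficients, and B is the half of B₀ on which
  -- adjacency to a fixed x₀ ∈ A is constant.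
  module SplitAt (U : VSet n) (U⊆W : U ⊆ W) (a b : Fin m) (tab : T a b ≡ true)
                 (A₀-third : size U ≤ 3 * size (U ∩ vside a b))
                 (A₀-at-most : 3 * size (U ∩ vside a b) ≤ 2 * size U) (big : 4 ≤ size U) where
    open Across a b tab

    A₀ B₀ : VSet n
    A₀ = U ∩ vside a b
    B₀ = U ∖ vside a b

    U≡A₀+B₀ : size U ≡ size A₀ + size B₀
    U≡A₀+B₀ = size-split U (vside a b)

    B₀-third : size U ≤ 3 * size B₀
    B₀-third = third-of-rest {a = size A₀} {b = size B₀} U≡A₀+B₀ A₀-at-most

    A₀-pos : 0 < size A₀
    A₀-pos = positive-part 3 (≤-trans (s≤s z≤n) big) A₀-third

    B₀-pos : 0 < size B₀
    B₀-pos = positive-part 3 (≤-trans (s≤s z≤n) big) B₀-third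

    refined : Σ (VSet n) λ A → A ⊆ A₀ × size A₀ ≤ 2 ^ k * size A ×
                (∀ x y → A x ≡ true → A y ≡ true → ∀ j → coefficients x j ≡ coefficients y j)
    refined = split-by-bits k coefficients A₀

    A : VSet n
    A = proj₁ refined

    A⊆A₀ : A ⊆ A₀
    A⊆A₀ = proj₁ (proj₂ refined)

    x₀ : Fin n
    x₀ = proj₁ (nonempty A (positive-part (2 ^ k) A₀-pos (proj₁ (proj₂ (proj₂ refined)))))

    x₀∈A : A x₀ ≡ true
    x₀∈A = proj₂ (nonempty A (positive-part (2 ^ k) A₀-pos (proj₁ (proj₂ (proj₂ refined)))))

    halved : Σ (VSet n) λ B → B ⊆ B₀ × size B₀ ≤ 2 * size B ×
               Σ Bool λ β → ∀ y → B y ≡ true → adj G x₀ y ≡ β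
    halved = halve B₀ (adj G x₀)

    B : VSet n
    B = proj₁ halved

    B⊆B₀ : B ⊆ B₀
    B⊆B₀ = proj₁ (proj₂ halved)

    β : Bool
    β = proj₁ (proj₂ (proj₂ (proj₂ halved)))

    on-side : ∀ {x} → A x ≡ true → vside a b x ≡ true
    on-side {x} e = ∧-conicalʳ (U x) _ (A⊆A₀ x e)

    off-side : ∀ {y} → B y ≡ true → vside a b y ≡ false
    off-side {y} e = proj₂ (∖-elim U (vside a b) (B⊆B₀ y e))

    joined : Joined β A B
    joined x y ex ey =
      trans (same-neighbours x x₀ y (U⊆W y (proj₁ (∖-elim U (vside a b) (B⊆B₀ y ey))))
                             (on-side ex) (on-side x₀∈A) (off-side ey)
                             (proj₂ (proj₂ (proj₂ refined)) x x₀ ex x₀∈A))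
            (proj₂ (proj₂ (proj₂ (proj₂ halved))) y ey)

    split : HomogeneousSplit (k + 3) U
    split = record
      { A = A ; B = B ; β = β
      ; A⊆U = λ x e → ∧-conicalˡ (U x) _ (A⊆A₀ x e)
      ; B⊆U = λ y e → proj₁ (∖-elim U (vside a b) (B⊆B₀ y e))
      ; disjoint = λ x ex ey → true≢false (on-side ex) (off-side ey)
      ; joined = joined
      ; A-large = fraction-bound k A₀-third (proj₁ (proj₂ (proj₂ refined))) (n≤1+n k)
      ; B-large = fraction-bound k B₀-third (proj₁ (proj₂ (proj₂ halved))) (s≤s z≤n)
      ; A-smaller = ≤-<-trans (size-mono A A₀ A⊆A₀)
                              (subst (size A₀ <_) (sym U≡A₀+B₀) (m<m+n (size A₀) B₀-pos))
      ; B-smaller = ≤-<-trans (size-mono B B₀ B⊆B₀)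
                              (subst (size B₀ <_) (sym U≡A₀+B₀) (m<n+m (size B₀) A₀-pos))
      }

  homogeneous-split : ∀ U → U ⊆ W → 4 ≤ size U → HomogeneousSplit (k + 3) U
  homogeneous-split U U⊆W big with Balance.balanced-edge U U⊆W big
  ... | a , b , tab , A₀-third , A₀-at-most = SplitAt.split U U⊆W a b tab A₀-third A₀-at-most big

  product-bound : ∀ U → U ⊆ W → ProductBound (k + 3) U
  product-bound = bound-by-splitting W (≤-trans (s≤s (s≤s z≤n)) (m≤n+m 3 k)) homogeneous-split

colour-class : {n : ℕ} → (Fin n → ℕ) → ℕ → VSet n
colour-class col c x = does (col x ≟ c)

-- Induction on N: either the class of
-- colour suc N or the best class among the other colours is large enough.
pigeonhole : {n : ℕ} (N : ℕ) (col : Fin n → ℕ) (U : VSet n) → (∀ x → U x ≡ true → col x < suc N) →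
             Σ ℕ λ c → c < suc N × size U ≤ suc N * size (U ∩ colour-class col c)
pigeonhole zero col U below = 0 , s≤s z≤n ,
  ≤-trans (size-mono U (U ∩ colour-class col 0) in-class) (≤-reflexive (sym (+-identityʳ _)))
  where
  in-class : U ⊆ (U ∩ colour-class col 0)
  in-class x ux = ∩-intro U (colour-class col 0) ux (dec-true (col x ≟ 0) (n<1⇒n≡0 (below x ux)))
pigeonhole (suc N) col U below = extend (pigeonhole N col (U ∖ last) below-N)
  where
  last : VSet _
  last = colour-class col (suc N)
  below-N : ∀ x → (U ∖ last) x ≡ true → col x < suc N
  below-N x e = ≤∧≢⇒< (s≤s⁻¹ (below x (proj₁ (∖-elim U last e))))
                       (λ eq → true≢false (dec-true (col x ≟ suc N) eq) (proj₂ (∖-elim U last e)))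
  class-size : ℕ → ℕ
  class-size c = size (U ∩ colour-class col c)
  narrow : ∀ c → size (U ∖ last ∩ colour-class col c) ≤ class-size c
  narrow c = size-mono (U ∖ last ∩ colour-class col c) (U ∩ colour-class col c) λ x e →
    ∩-intro U (colour-class col c) (proj₁ (∖-elim U last (∧-conicalˡ ((U ∖ last) x) _ e)))
                                   (∧-conicalʳ ((U ∖ last) x) _ e)
  larger-class : ∀ c → c < suc N → size (U ∖ last) ≤ suc N * class-size c →
                 Σ ℕ λ c′ → c′ < suc (suc N) × size U ≤ suc (suc N) * class-size c′
  larger-class c c<N rest≤c with ≤-total (class-size c) (class-size (suc N))
  ... | inj₁ c≤last = suc N , ≤-refl , add-class {k = suc N} (size-split U last) rest≤c ≤-refl c≤last
  ... | inj₂ last≤c = c , m≤n⇒m≤1+n c<N , add-class {k = suc N} (size-split U last) rest≤c last≤c ≤-refl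
  extend : (Σ ℕ λ c → c < suc N × size (U ∖ last) ≤ suc N * size (U ∖ last ∩ colour-class col c)) →
           Σ ℕ λ c → c < suc (suc N) × size U ≤ suc (suc N) * class-size c
  extend (c , c<N , rest≤) = larger-class c c<N (≤-trans rest≤ (*-monoʳ-≤ (suc N) (narrow c)))

popular-class : {n N : ℕ} (col : Fin (suc n) → Fin N) →
                Σ (Fin N) λ c → suc n ≤ N * size (λ x → col x == c)
popular-class {n} {zero} col with col zero
... | ()
popular-class {n} {suc N} col with pigeonhole N (toℕ ∘ col) (λ _ → true) (λ x _ → toℕ<n (col x))
... | c , c<N , all≤ =
  fromℕ< c<N , subst (_≤ suc N * size (λ x → col x == fromℕ< c<N)) size-full
                 (≤-trans all≤ (*-monoʳ-≤ (suc N) (size-mono _ _ same-class)))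
  where
  same-class : ((λ _ → true) ∩ colour-class (toℕ ∘ col) c) ⊆ (λ x → col x == fromℕ< c<N)
  same-class x e = dec-true (col x ≟ᶠ fromℕ< c<N)
    (toℕ-injective (trans (does-true (toℕ (col x) ≟ c) e) (sym (toℕ-fromℕ< c<N))))

tabulate-∈ : {n : ℕ} (U : VSet n) {x : Fin n} → x ∈ tabulate U → U x ≡ true
tabulate-∈ U {x} x∈ = trans (sym (lookup∘tabulate U x)) ([]=⇒lookup x∈)

power≤1 : ∀ {p} d → p ≤ 1 → p ^ d ≤ 1
power≤1 {zero} zero    _ = ≤-refl
power≤1 {zero} (suc d) _ = z≤n
power≤1 {suc zero} d   _ = ≤-reflexive (^-zeroˡ d)
power≤1 {suc (suc _)} d (s≤s ())

square≥2 : ∀ {s} → 2 ≤ s * s → 2 ≤ s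
square≥2 {suc (suc s)} _ = s≤s (s≤s z≤n)
square≥2 {suc zero} (s≤s ())
square≥2 {zero} ()

module Conclusion {n : ℕ} (G : Graph (Fin n)) where
  open Homogeneity G

  HomogeneousSubset : Subset n → Set
  HomogeneousSubset S = IsIndependent G S ⊎ IsClique G S

  homogeneous-subset : ∀ β X → Homogeneous β X → HomogeneousSubset (tabulate X)
  homogeneous-subset false X h = inj₁ λ x y x∈ y∈ → independent x y (tabulate-∈ X x∈) (tabulate-∈ X y∈)
    where
    independent : ∀ x y → X x ≡ true → X y ≡ true → adj G x y ≡ false
    independent x y ex ey with x ≟ᶠ y
    ... | yes refl = irrefl G x
    ... | no x≢y   = h x y ex ey x≢y
  homogeneous-subset true X h = inj₂ λ x y x∈ y∈ → h x y (tabulate-∈ X x∈) (tabulate-∈ X y∈)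

  large-homogeneous : ∀ {d U} N → ProductBound d U → 2 ≤ size U → n ≤ N * size U →
                      Σ (Subset n) λ S → HomogeneousSubset S × n ^ 1 ≤ ∣ S ∣ ^ (N + 2 * d)
  large-homogeneous {d} {U} N PB 2≤U n≤ =
    tabulate S , proj₁ (proj₂ chosen) ,
    subst₂ _≤_ (sym (*-identityʳ n)) (cong (_^ (N + 2 * d)) (sym (size-tabulate S)))
      (power-absorbs {N = N} {M = size S} d (square≥2 (≤-trans 2≤p p≤S²))
        (≤-trans n≤ (*-monoʳ-≤ N (≤-trans bound (^-monoˡ-≤ d p≤S²)))))
    where
    open ProductBound PB
    chosen : Σ (VSet n) λ S → HomogeneousSubset (tabulate S) × size (part false) ⊔ size (part true) ≤ size S
    chosen = larger-of (HomogeneousSubset ∘ tabulate) (part false) (part true)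
               (homogeneous-subset false (part false) (homogeneous false))
               (homogeneous-subset true (part true) (homogeneous true))
    S : VSet n
    S = proj₁ chosen
    p : ℕ
    p = size (part false) * size (part true)
    p≤S² : p ≤ size S * size S
    p≤S² = *-mono-≤ (≤-trans (m≤m⊔n (size (part false)) _) (proj₂ (proj₂ chosen)))
                    (≤-trans (m≤n⊔m _ (size (part true))) (proj₂ (proj₂ chosen)))
    -- since 2 ≤ |U| ≤ p^d
    2≤p : 2 ≤ p
    2≤p with 2 ≤? p
    ... | yes 2≤p = 2≤p
    ... | no  2≰p = ⊥-elim (<⇒≱ 2≤U (≤-trans bound (power≤1 d (s≤s⁻¹ (≰⇒> 2≰p)))))

class⊆W : {n N : ℕ} (col : Fin n → Fin N) (c : Fin N) → (λ x → col x == c) ⊆ (λ v → lookup ⁅ c ⁆ (col v))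
class⊆W col c x e =
  subst (λ z → lookup ⁅ c ⁆ z ≡ true) (sym (does-true (col x ≟ᶠ c) e)) ([]=⇒lookup (x∈⁅x⁆ c))

class-bound : {n N k : ℕ} (G : Graph (Fin n)) (col : Fin n → Fin N) (c : Fin N) →
              RankWidthLE (induced G (λ v → lookup ⁅ c ⁆ (col v))) k →
              Homogeneity.ProductBound G (k + 3) (λ x → col x == c)
class-bound G col c (inj₁ all-equal) =
  Homogeneity.tiny-bound G (size-≤1 _ λ x y ex ey →
    cong proj₁ (all-equal (x , class⊆W col c x ex) (y , class⊆W col c y ey)))
class-bound G col c (inj₂ RD) = Decomposition.product-bound G _ RD _ (class⊆W col c)

-- A graph on n ≥ 2 vertices with an N-colouring whose colour classes induce
-- subgraphs of rank-width at most k has a homogeneous set S with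
-- n ≤ |S|^(N + 2(k+3)): a largest class U has at least n/N vertices and
-- satisfies the product bound; if U has fewer than two vertices, then n ≤ N
-- and the first two vertices, with their product bound, serve instead.
coloured-bound : {n N k : ℕ} (G : Graph (Fin (suc (suc n)))) (col : Fin (suc (suc n)) → Fin N) →
                 (∀ c → RankWidthLE (induced G (λ v → lookup ⁅ c ⁆ (col v))) k) →
                 Σ (Subset (suc (suc n))) λ S → Conclusion.HomogeneousSubset G S ×
                   suc (suc n) ^ 1 ≤ ∣ S ∣ ^ (N + 2 * (k + 3))
coloured-bound {n} {N} {k} G col width with popular-class col
... | c , n≤ with 2 ≤? size (λ x → col x == c)
...   | yes 2≤U = Conclusion.large-homogeneous G N (class-bound G col c (width c)) 2≤U n≤
...   | no  2≰U = Conclusion.large-homogeneous G N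
                    (Homogeneity.small-bound G {U = pair} 2≤d (≤-trans (≤-reflexive pair-size) (n≤1+n 2)))
                    (≤-reflexive (sym pair-size)) n≤pair
  where
  pair : VSet (suc (suc n))
  pair = single zero ∪ single (suc zero)
  pair-size : size pair ≡ 2
  pair-size = size-pair {n = suc (suc n)} {x = zero} {y = suc zero} (λ ())
  2≤d : 2 ≤ k + 3
  2≤d = ≤-trans (s≤s (s≤s z≤n)) (m≤n+m 3 k)
  n≤pair : suc (suc n) ≤ N * size pair
  n≤pair = ≤-trans n≤ (*-monoʳ-≤ N (≤-trans (s≤s⁻¹ (≰⇒> 2≰U))
                                             (≤-trans (n≤1+n 1) (≤-reflexive (sym pair-size)))))

-- With p = 1 every colour class has rank-width at most Q(1), so the theorem
-- holds with ε = 1/(N(1) + 2(Q(1) + 3)); graphs with at most one vertex are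
-- independent sets.
proposition1 : (C : GraphClass) → LowRankWidthColorings C → ErdosHajnal C
proposition1 C (N , Q , colouring) = 1 , N 1 + 2 * (Q 1 + 3) , ≤-refl , exponent-positive , large-set
  where
  exponent-positive : 1 ≤ N 1 + 2 * (Q 1 + 3)
  exponent-positive = ≤-trans (≤-trans (s≤s z≤n) (m≤n+m 3 (Q 1)))
                      (≤-trans (m≤m+n (Q 1 + 3) (Q 1 + 3 + 0)) (m≤n+m (2 * (Q 1 + 3)) (N 1)))

  large-set : ∀ n (G : Graph (Fin n)) → C n G →
              Σ (Subset n) λ S → (IsIndependent G S ⊎ IsClique G S) × n ^ 1 ≤ ∣ S ∣ ^ (N 1 + 2 * (Q 1 + 3))
  large-set zero            G _   = [] , inj₁ (λ ()) , z≤n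
  large-set (suc zero)      G _   = inside ∷ [] , inj₁ (λ { zero zero _ _ → irrefl G zero }) ,
                                    ≤-reflexive (sym (^-zeroˡ (N 1 + 2 * (Q 1 + 3))))
  large-set n@(suc (suc _)) G inC with colouring 1 n G inC
  ... | col , low-width = coloured-bound G col λ c →
    subst (λ i → RankWidthLE (induced G (λ v → lookup ⁅ c ⁆ (col v))) (Q i)) (∣⁅x⁆∣≡1 c)
          (low-width ⁅ c ⁆ (≤-reflexive (∣⁅x⁆∣≡1 c)))
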